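{- Consider a filling of a one-column shape by positive integers with largest entry $n$, which occurs $m$ times. There is a unique ordering $n_1,\dots,n_m$ of the cells containing $n$ such that: (1) within any maximal run of consecutive cells of the column all filled with $n$, these cells appear in the ordering from bottom to top; and (2) if the cells $n_1,\dots,n_m$ are removed one at a time in this order (closing up the column each time) and $d_i$ denotes the amount by which the major index of the column decreases at the $i$-th removal, then $d_1\le d_2\le\cdots\le d_m$.
   Context: The major index of a column read from top to bottom as $w_1\cdots w_r$ is the sum of the indices $k$ with $w_k>w_{k+1}$. -}

module Defs where

open import Data.Nat using (ℕ; zero; suc; _+_; _<_; _≤_; _<?_; _≟_)
open import Data.Bool using (if_then_else_)
open import Data.Fin using (Fin; toℕ)
import Data.Fin as Fin
open import Data.List using (List; []; _∷_; _++_; map; filter; take; length; lookup; upTo; allFin)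
open import Data.List.Membership.Propositional using (_∈_)
import Data.List.Membership.DecPropositional as DecMem
open import Data.List.Relation.Binary.Permutation.Propositional using (_↭_)
open import Data.List.Relation.Unary.Linked using (Linked)
open import Data.Integer as ℤ using (ℤ; +_; _-_)
open import Data.Product using (∃; ∃-syntax; _×_; _,_)
open import Relation.Nullary using (¬?; does)
open import Relation.Binary.PropositionalEquality using (_≡_)

-- A column filling is a list w = w₁ ⋯ w_r read top to bottom;
-- cells are identified by their positions Fin (length w) (0 = top).

majFrom : ℕ → List ℕ → ℕ
majFrom k [] = 0
majFrom k (x ∷ []) = 0
majFrom k (x ∷ y ∷ ys) =
  (if does (y <? x) then k else 0) + majFrom (suc k) (y ∷ ys)

maj : List ℕ → ℕ
maj = majFrom 1

cellsOf : (w : List ℕ) → ℕ → List (Fin (length w))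
cellsOf w n = filter (λ i → lookup w i ≟ n) (allFin (length w))

removeCells : (w : List ℕ) → List (Fin (length w)) → List ℕ
removeCells w R = map (lookup w) (filter (λ i → ¬? (i ∈? R)) (allFin (length w)))
  where open DecMem (Fin._≟_ {length w}) using (_∈?_)

decreases : (w : List ℕ) → List (Fin (length w)) → List ℤ
decreases w o =
  map (λ k → + maj (removeCells w (take k o)) - + maj (removeCells w (take (suc k) o)))
      (upTo (length o))

Before : {A : Set} → A → A → List A → Set
Before a b o = ∃[ xs ] ∃[ ys ] ∃[ zs ] (o ≡ xs ++ a ∷ ys ++ b ∷ zs)

SameRun : (w : List ℕ) → ℕ → Fin (length w) → Fin (length w) → Set
SameRun w n i j = (toℕ i < toℕ j)
  × (∀ (k : Fin (length w)) → toℕ i ≤ toℕ k → toℕ k ≤ toℕ j → lookup w k ≡ n)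

GoodOrdering : (w : List ℕ) → ℕ → List (Fin (length w)) → Set
GoodOrdering w n o =
  (o ↭ cellsOf w n)
  × (∀ i j → SameRun w n i j → Before j i o)
  × Linked ℤ._≤_ (decreases w o)

-- Write d_R(x) for the decrease of the major index when the n-cell x is removed after the cells R.
-- Removing an n from a word a ++ n ∷ b lowers maj by an explicit amount (removalCost), built from the
-- descents of b, the letter after the n, and the last letter and length of a. Comparing these
-- amounts for two n-cells x above z gives: d(x) = d(z) exactly when every cell between them still
-- present is an n, i.e. when x and z lie in one run; otherwise removing either of them lowers the
-- other's d by 0 or 1; and after removing the lower cell of a run, the upper one's d is at least the
-- removed one's. Hence the greedy ordering, which always removes a cell of least d and the lowest
-- one among ties, has d₁ ≤ d₂ ≤ ⋯ and takes every run from bottom to top. Conversely, the first cell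
-- of any ordering with properties (1) and (2) is forced to be that greedy choice, and uniqueness
-- follows by induction.

module Submission where

open import Defs
open import Data.Nat using (ℕ; suc; _+_; _∸_; _≤_; _<_; z≤n; s≤s; _<ᵇ_; _<?_; _≟_)
open import Data.Nat.Properties
open import Data.Nat.Tactic.RingSolver using (solve-∀)
open import Data.Integer as ℤ using (ℤ; +_; _-_)
import Data.Integer.Properties as ℤ
open import Data.Fin as Fin using (Fin; toℕ)
import Data.Fin.Properties as Fin
open import Data.Bool using (true; false; if_then_else_)
open import Data.List using (List; []; _∷_; _++_; [_]; map; filter; length; lookup; allFin; take; upTo; applyUpTo)
open import Data.List.Properties
  using ( ++-assoc; ++-identityʳ; ∷-injectiveˡ; ∷-injectiveʳ; map-++; map-cong; map-applyUpTo; map-upTo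
        ; filter-++; filter-accept; filter-reject)
open import Data.List.Membership.Propositional using (_∈_; _∉_)
open import Data.List.Membership.Propositional.Properties
  using (∈-allFin; ∈-lookup; ∈-map⁺; ∈-++⁻; ∈-++⁺ʳ; ∈-∃++; ∈-filter⁺; ∈-filter⁻)
import Data.List.Membership.DecPropositional as DecMembership
open import Data.List.Relation.Unary.All as All using (All; []; _∷_)
open import Data.List.Relation.Unary.All.Properties using (++⁺; ++⁻ˡ; ++⁻ʳ; map⁺)
open import Data.List.Relation.Unary.Any using (here; there; any?)
open import Data.List.Relation.Unary.AllPairs using (AllPairs; []; _∷_)
open import Data.List.Relation.Unary.AllPairs.Properties using (tabulate⁺-<)
open import Data.List.Relation.Unary.Linked using (Linked; []; [-]; _∷_; tail)
open import Data.List.Relation.Unary.Linked.Properties using (Linked⇒All)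
open import Data.List.Relation.Unary.Unique.Propositional using (Unique; []; _∷_)
open import Data.List.Relation.Unary.Unique.Propositional.Properties using (Unique[x∷xs]⇒x∉xs; filter⁺; allFin⁺)
open import Data.List.Relation.Binary.Permutation.Propositional using (_↭_; ↭-refl; ↭-sym; ↭-trans; ↭-prep; ↭⇒↭ₛ)
open import Data.List.Relation.Binary.Permutation.Propositional.Properties using (∈-resp-↭; shift; drop-∷; ↭-length)
open import Data.List.Relation.Binary.Permutation.Setoid.Properties using (Unique-resp-↭)
open import Data.Product using (∃; ∃₂; ∃-syntax; _×_; _,_; proj₁; proj₂)
open import Data.Product.Relation.Binary.Lex.NonStrict using (×-Lex; ×-totalOrder)
open import Data.Sum using (_⊎_; inj₁; inj₂)
open import Data.Empty using (⊥-elim)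
open import Function using (_∘_; case_of_; flip)
open import Relation.Nullary using (¬_; ¬?; Dec; yes; no; does)
open import Relation.Nullary.Reflects using (ofʸ; ofⁿ)
open import Relation.Binary.Definitions using (Tri; tri<; tri≈; tri>)
import Relation.Binary.Construct.Flip.EqAndOrd as Flip
open import Relation.Binary.PropositionalEquality hiding ([_])

-- Removing a largest letter from a word

descentAt : ℕ → ℕ → ℕ
descentAt x y = if does (y <? x) then 1 else 0

descents : List ℕ → ℕ
descents []           = 0
descents (x ∷ [])     = 0
descents (x ∷ y ∷ ys) = descentAt x y + descents (y ∷ ys)

≤⇒≮ᵇ : ∀ {x y} → x ≤ y → (y <ᵇ x) ≡ false
≤⇒≮ᵇ {x} {y} x≤y with y <ᵇ x | <ᵇ-reflects-< y x
... | true  | ofʸ y<x = ⊥-elim (<⇒≱ y<x x≤y)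
... | false | _       = refl

descentAt-≤1 : ∀ x y → descentAt x y ≤ 1
descentAt-≤1 x y with y <ᵇ x
... | true  = ≤-refl
... | false = z≤n

majFrom-suc : ∀ k xs → majFrom (suc k) xs ≡ majFrom k xs + descents xs
majFrom-suc k []           = refl
majFrom-suc k (x ∷ [])     = refl
majFrom-suc k (x ∷ y ∷ ys) rewrite majFrom-suc (suc k) (y ∷ ys) with y <ᵇ x
... | true  = rearrange k (majFrom (suc k) (y ∷ ys)) (descents (y ∷ ys))
  where rearrange : ∀ k m d → suc k + (m + d) ≡ k + m + (1 + d)
        rearrange = solve-∀
... | false = refl

descents-≤ : ∀ x xs → descents (x ∷ xs) ≤ length xs
descents-≤ x []       = z≤n
descents-≤ x (y ∷ ys) = +-mono-≤ (descentAt-≤1 x y) (descents-≤ y ys)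

-- The part of maj (a ++ n ∷ h ∷ b) − maj (a ++ h ∷ b) coming from the junction, when the first letter
-- of a has index k: it is 0 unless h < n, and then 1 if a ends with a letter > h and k + length a otherwise.
joinCost : (n k : ℕ) → List ℕ → ℕ → ℕ
joinCost n k []          h = if does (h <? n) then k else 0
joinCost n k (x ∷ [])    h = if does (h <? n) then (if does (h <? x) then 1 else suc k) else 0
joinCost n k (x ∷ y ∷ r) h = joinCost n (suc k) (y ∷ r) h

removalCost : (n k : ℕ) → List ℕ → List ℕ → ℕ
removalCost n k a []      = 0
removalCost n k a (h ∷ b) = joinCost n k a h + descents (h ∷ b)

majFrom-insertMax : ∀ {n} k a b → All (_≤ n) a →
  majFrom k (a ++ n ∷ b) ≡ majFrom k (a ++ b) + removalCost n k a b
majFrom-insertMax         k []          []      _ = refl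
majFrom-insertMax {n}     k []          (h ∷ b) _
  rewrite majFrom-suc k (h ∷ b) = swap (if does (h <? n) then k else 0) (majFrom k (h ∷ b)) (descents (h ∷ b))
  where swap : ∀ t m d → t + (m + d) ≡ m + (t + d)
        swap = solve-∀
majFrom-insertMax         k (x ∷ [])    []      (x≤n ∷ []) rewrite ≤⇒≮ᵇ x≤n = refl
majFrom-insertMax {n}     k (x ∷ [])    (h ∷ b) (x≤n ∷ [])
  rewrite ≤⇒≮ᵇ x≤n | majFrom-suc (suc k) (h ∷ b)
  with h <ᵇ n | <ᵇ-reflects-< h n | h <ᵇ x | <ᵇ-reflects-< h x
... | true  | _       | true  | _       = rearrange k (majFrom (suc k) (h ∷ b)) (descents (h ∷ b))
  where rearrange : ∀ k m d → suc k + (m + d) ≡ k + m + (1 + d)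
        rearrange = solve-∀
... | true  | _       | false | _       = rearrange k (majFrom (suc k) (h ∷ b)) (descents (h ∷ b))
  where rearrange : ∀ k m d → suc k + (m + d) ≡ m + (suc k + d)
        rearrange = solve-∀
... | false | ofⁿ h≮n | true  | ofʸ h<x = ⊥-elim (h≮n (<-≤-trans h<x x≤n))
... | false | _       | false | _       = refl
majFrom-insertMax         k (x ∷ y ∷ r) []      (_ ∷ r≤n)
  rewrite majFrom-insertMax (suc k) (y ∷ r) [] r≤n = sym (+-assoc (if does (y <? x) then k else 0) _ _)
majFrom-insertMax         k (x ∷ y ∷ r) (h ∷ b) (_ ∷ r≤n)
  rewrite majFrom-insertMax (suc k) (y ∷ r) (h ∷ b) r≤n = sym (+-assoc (if does (y <? x) then k else 0) _ _)

joinCost-++ : ∀ n k a y ys h → joinCost n k (a ++ y ∷ ys) h ≡ joinCost n (k + length a) (y ∷ ys) h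
joinCost-++ n k []           y ys h rewrite +-identityʳ k = refl
joinCost-++ n k (x ∷ [])     y ys h rewrite +-comm k 1 = refl
joinCost-++ n k (x ∷ x′ ∷ r) y ys h
  rewrite joinCost-++ n (suc k) (x′ ∷ r) y ys h | +-suc k (length (x′ ∷ r)) = refl

joinCost-suc : ∀ n k y ys h →
  joinCost n k (y ∷ ys) h ≤ joinCost n (suc k) (y ∷ ys) h ×
  joinCost n (suc k) (y ∷ ys) h ≤ suc (joinCost n k (y ∷ ys) h)
joinCost-suc n k y (z ∷ zs) h = joinCost-suc n (suc k) z zs h
joinCost-suc n k y []       h with h <ᵇ n | h <ᵇ y
... | true  | true  = ≤-refl , n≤1+n 1
... | true  | false = n≤1+n _ , ≤-refl
... | false | _     = z≤n , z≤n

joinCost-run : ∀ {n} k c h → All (_≡ n) c → joinCost n k (n ∷ c) h ≡ descentAt n h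
joinCost-run {n} k []      h []          with h <ᵇ n
... | true  = refl
... | false = refl
joinCost-run     k (_ ∷ c) h (refl ∷ c≡n) = joinCost-run (suc k) c h c≡n

descentAt-≤-joinCost : ∀ n k a h → 1 ≤ k → descentAt n h ≤ joinCost n k a h
descentAt-≤-joinCost n k []          h 1≤k with h <ᵇ n
... | true  = 1≤k
... | false = z≤n
descentAt-≤-joinCost n k (x ∷ [])    h 1≤k with h <ᵇ n | h <ᵇ x
... | true  | true  = ≤-refl
... | true  | false = s≤s z≤n
... | false | _     = z≤n
descentAt-≤-joinCost n k (x ∷ y ∷ r) h 1≤k = descentAt-≤-joinCost n (suc k) (y ∷ r) h (m≤n⇒m≤1+n 1≤k)

joinCost-≤ : ∀ n k a h → joinCost n k a h ≤ k + length a
joinCost-≤ n k []          h with h <ᵇ n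
... | true  = m≤m+n k 0
... | false = z≤n
joinCost-≤ n k (x ∷ [])    h rewrite +-comm k 1 with h <ᵇ n | h <ᵇ x
... | true  | true  = s≤s z≤n
... | true  | false = ≤-refl
... | false | _     = z≤n
joinCost-≤ n k (x ∷ y ∷ r) h =
  ≤-trans (joinCost-≤ n (suc k) (y ∷ r) h) (≤-reflexive (sym (+-suc k (length (y ∷ r)))))

joinCost-values : ∀ n k y ys h →
  joinCost n k (y ∷ ys) h ≡ 0 × descentAt n h ≡ 0 ⊎
  (joinCost n k (y ∷ ys) h ≡ 1 ⊎ joinCost n k (y ∷ ys) h ≡ k + length (y ∷ ys)) × descentAt n h ≡ 1
joinCost-values n k y (z ∷ zs) h =
  subst (λ m → cost ≡ 0 × descentAt n h ≡ 0 ⊎ (cost ≡ 1 ⊎ cost ≡ m) × descentAt n h ≡ 1)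
        (sym (+-suc k (length (z ∷ zs)))) (joinCost-values n (suc k) z zs h)
  where cost : ℕ
        cost = joinCost n (suc k) (z ∷ zs) h
joinCost-values n k y []       h rewrite +-comm k 1 with h <ᵇ n | h <ᵇ y
... | true  | true  = inj₂ (inj₁ refl , refl)
... | true  | false = inj₂ (inj₂ refl , refl)
... | false | _     = inj₁ (refl , refl)

descents-++-max : ∀ {n} x xs e → All (_≤ n) (x ∷ xs) →
  descents (x ∷ xs ++ n ∷ e) ≡ descents (x ∷ xs) + descents (n ∷ e)
descents-++-max x []       e (x≤n ∷ [])   rewrite ≤⇒≮ᵇ x≤n = refl
descents-++-max x (y ∷ ys) e (_ ∷ ys≤n) rewrite descents-++-max y ys e ys≤n =
  sym (+-assoc (descentAt x y) _ _)

descents-run : ∀ {n} x xs e → All (_≡ n) (x ∷ xs) → descents (x ∷ xs ++ e) ≡ descents (n ∷ e)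
descents-run x []       e (refl ∷ [])          = refl
descents-run x (y ∷ ys) e (refl ∷ refl ∷ ys≡n) rewrite ≤⇒≮ᵇ (≤-refl {x}) = descents-run y ys e (refl ∷ ys≡n)

descents-insertMax : ∀ {n} x xs e → All (_≤ n) (x ∷ xs) →
  descents (x ∷ xs ++ e) ≤ descents (x ∷ xs ++ n ∷ e) ×
  descents (x ∷ xs ++ n ∷ e) ≤ suc (descents (x ∷ xs ++ e))
descents-insertMax x (y ∷ ys) e (_ ∷ ys≤n) with descents-insertMax y ys e ys≤n
... | lo , hi = +-monoʳ-≤ (descentAt x y) lo , ≤-trans (+-monoʳ-≤ (descentAt x y) hi) (≤-reflexive (+-suc _ _))
descents-insertMax x [] [] (x≤n ∷ []) rewrite ≤⇒≮ᵇ x≤n = z≤n , z≤n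
descents-insertMax {n} x [] (h ∷ e) (x≤n ∷ [])
  rewrite ≤⇒≮ᵇ x≤n with h <ᵇ n | <ᵇ-reflects-< h n | h <ᵇ x | <ᵇ-reflects-< h x
... | true  | _       | true  | _       = ≤-refl , n≤1+n _
... | true  | _       | false | _       = n≤1+n _ , ≤-refl
... | false | ofⁿ h≮n | true  | ofʸ h<x = ⊥-elim (h≮n (<-≤-trans h<x x≤n))
... | false | _       | false | _       = ≤-refl , n≤1+n _

descents-pos : ∀ {n} xs → All (_≤ n) xs → ¬ All (_≡ n) xs → 1 ≤ descents (n ∷ xs)
descents-pos     []       _           xs≢n = ⊥-elim (xs≢n [])
descents-pos {n} (x ∷ xs) (x≤n ∷ xs≤n) xs≢n with x <ᵇ n | <ᵇ-reflects-< x n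
... | true  | _       = s≤s z≤n
... | false | ofⁿ x≮n with ≤-antisym x≤n (≮⇒≥ x≮n)
...   | refl = descents-pos xs xs≤n (λ xs≡n → xs≢n (refl ∷ xs≡n))

removalCost-insertLeft : ∀ n a y ys e →
  removalCost n 1 (a ++ y ∷ ys) e ≤ removalCost n 1 (a ++ n ∷ y ∷ ys) e ×
  removalCost n 1 (a ++ n ∷ y ∷ ys) e ≤ suc (removalCost n 1 (a ++ y ∷ ys) e)
removalCost-insertLeft n a y ys []      = z≤n , z≤n
removalCost-insertLeft n a y ys (h ∷ e)
  rewrite joinCost-++ n 1 a y ys h | joinCost-++ n 1 a n (y ∷ ys) h
  with joinCost-suc n (suc (length a)) y ys h
... | lo , hi = +-monoˡ-≤ (descents (h ∷ e)) lo , +-monoˡ-≤ (descents (h ∷ e)) hi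

removalCost-insertRight : ∀ n a x xs e → All (_≤ n) (x ∷ xs) →
  removalCost n 1 a (x ∷ xs ++ e) ≤ removalCost n 1 a (x ∷ xs ++ n ∷ e) ×
  removalCost n 1 a (x ∷ xs ++ n ∷ e) ≤ suc (removalCost n 1 a (x ∷ xs ++ e))
removalCost-insertRight n a x xs e c≤n with descents-insertMax x xs e c≤n
... | lo , hi = +-monoʳ-≤ (joinCost n 1 a x) lo ,
                ≤-trans (+-monoʳ-≤ (joinCost n 1 a x) hi) (≤-reflexive (+-suc _ _))

removalCost-run-≤ : ∀ {n} a c e → All (_≡ n) c → removalCost n 1 (a ++ n ∷ c) e ≤ removalCost n 1 a (c ++ e)
removalCost-run-≤     a c []      _   = z≤n
removalCost-run-≤ {n} a c (h ∷ e) c≡n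
  rewrite joinCost-++ n 1 a n c h | joinCost-run (suc (length a)) c h c≡n = descents≤cost c c≡n
  where
  descents≤cost : ∀ c → All (_≡ n) c → descents (n ∷ h ∷ e) ≤ removalCost n 1 a (c ++ h ∷ e)
  descents≤cost []       _   = +-monoˡ-≤ (descents (h ∷ e)) (descentAt-≤-joinCost n 1 a h ≤-refl)
  descents≤cost (x ∷ xs) c≡n rewrite descents-run x xs (h ∷ e) c≡n = m≤n+m _ (joinCost n 1 a x)

run-comm : ∀ {n : ℕ} (c e : List ℕ) → All (_≡ n) c → n ∷ c ++ e ≡ c ++ n ∷ e
run-comm     []      e []           = refl
run-comm {n} (_ ∷ c) e (refl ∷ c≡n) = cong (n ∷_) (run-comm c e c≡n)

-- Both sides equal maj (a ++ n ∷ c ++ n ∷ e) − maj (a ++ c ++ n ∷ e), since a run of n's commutes with an n.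
removalCost-run : ∀ {n} a c e → All (_≤ n) a → All (_≡ n) c →
  removalCost n 1 a (c ++ n ∷ e) ≡ removalCost n 1 (a ++ n ∷ c) e
removalCost-run {n} a c e a≤n c≡n = +-cancelˡ-≡ (maj (a ++ c ++ n ∷ e)) _ _ (begin
  maj (a ++ c ++ n ∷ e) + removalCost n 1 a (c ++ n ∷ e)  ≡⟨ majFrom-insertMax 1 a (c ++ n ∷ e) a≤n ⟨
  maj (a ++ n ∷ c ++ n ∷ e)                              ≡⟨ cong maj (++-assoc a (n ∷ c) (n ∷ e)) ⟨
  maj ((a ++ n ∷ c) ++ n ∷ e)                            ≡⟨ majFrom-insertMax 1 (a ++ n ∷ c) e an≤n ⟩
  maj ((a ++ n ∷ c) ++ e) + removalCost n 1 (a ++ n ∷ c) e ≡⟨ cong ((_+ removalCost n 1 (a ++ n ∷ c) e) ∘ maj) moveRun ⟩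
  maj (a ++ c ++ n ∷ e) + removalCost n 1 (a ++ n ∷ c) e  ∎)
  where
  open ≡-Reasoning
  an≤n : All (_≤ n) (a ++ n ∷ c)
  an≤n = ++⁺ a≤n (All.map ≤-reflexive (refl ∷ c≡n))
  moveRun : (a ++ n ∷ c) ++ e ≡ a ++ c ++ n ∷ e
  moveRun = trans (++-assoc a (n ∷ c) e) (cong (a ++_) (run-comm c e c≡n))

-- The left side is q + descents (n ∷ e) with 1 ≤ q ≤ length a + length c, while the junction term on the
-- right is 0, 1 or length a + length c + 2, according to joinCost-values; none of these fits.
removalCost-≢ : ∀ {n} a c e → All (_≤ n) c → ¬ All (_≡ n) c →
  removalCost n 1 a (c ++ n ∷ e) ≢ removalCost n 1 (a ++ n ∷ c) e
removalCost-≢         a []       e _          c≢n _  = c≢n []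
removalCost-≢ {n}     a (x ∷ xs) e (x≤n ∷ xs≤n) c≢n eq
  rewrite descents-++-max x xs e (x≤n ∷ xs≤n) | sym (+-assoc (joinCost n 1 a x) (descents (x ∷ xs)) (descents (n ∷ e)))
  = separated e eq
  where
  q : ℕ
  q = joinCost n 1 a x + descents (x ∷ xs)

  1≤q : 1 ≤ q
  1≤q with x <ᵇ n | <ᵇ-reflects-< x n | descentAt-≤-joinCost n 1 a x ≤-refl
  ... | true  | _       | 1≤J = ≤-trans 1≤J (m≤m+n _ _)
  ... | false | ofⁿ x≮n | _ with ≤-antisym x≤n (≮⇒≥ x≮n)
  ...   | refl = ≤-trans (descents-pos xs xs≤n (λ xs≡n → c≢n (refl ∷ xs≡n))) (m≤n+m _ _)

  q<last : suc q < suc (suc (length a)) + length (x ∷ xs)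
  q<last = s≤s (s≤s (≤-trans (+-mono-≤ (joinCost-≤ n 1 a x) (descents-≤ x xs))
                             (≤-reflexive (sym (+-suc (length a) (length xs))))))

  q+d≡J : ∀ h e → q + descents (n ∷ h ∷ e) ≡ removalCost n 1 (a ++ n ∷ x ∷ xs) (h ∷ e) →
          ∀ {d J} → descentAt n h ≡ d → joinCost n (suc (suc (length a))) (x ∷ xs) h ≡ J → q + d ≡ J
  q+d≡J h e eq refl refl rewrite joinCost-++ n 1 a n (x ∷ xs) h =
    +-cancelʳ-≡ (descents (h ∷ e)) _ _ (trans (+-assoc q (descentAt n h) _) eq)

  separated : ∀ e → q + descents (n ∷ e) ≢ removalCost n 1 (a ++ n ∷ x ∷ xs) e
  separated []      eq = n≮0 (subst (1 ≤_) (trans (sym (+-identityʳ q)) eq) 1≤q)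
  separated (h ∷ e) eq with joinCost-values n (suc (suc (length a))) x xs h
  ... | inj₁ (J≡0 , d≡0)         = n≮0 (subst (1 ≤_) (trans (sym (+-identityʳ q)) (q+d≡J h e eq d≡0 J≡0)) 1≤q)
  ... | inj₂ (inj₁ J≡1 , d≡1)    = n≮0 (subst (1 ≤_) (suc-injective (trans (+-comm 1 q) (q+d≡J h e eq d≡1 J≡1))) 1≤q)
  ... | inj₂ (inj₂ J≡last , d≡1) = <-irrefl (trans (+-comm 1 q) (q+d≡J h e eq d≡1 J≡last)) q<last

-- Removing cells from the column

sortedSplit : ∀ {A : Set} {_≺_ : A → A → Set} {L x} → AllPairs _≺_ L → x ∈ L →
  ∃₂ λ L₁ L₂ → L ≡ L₁ ++ x ∷ L₂ × All (_≺ x) L₁ × All (x ≺_) L₂ × AllPairs _≺_ L₂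
sortedSplit {L = y ∷ L} (y≺L ∷ sorted) (here refl) = [] , L , refl , [] , y≺L , sorted
sortedSplit {L = y ∷ L} (y≺L ∷ sorted) (there x∈L) with sortedSplit sorted x∈L
... | L₁ , L₂ , refl , L₁≺x , x≺L₂ , sorted₂ =
  y ∷ L₁ , L₂ , refl , All.lookup y≺L x∈L ∷ L₁≺x , x≺L₂ , sorted₂

module Removal (w : List ℕ) where

  Cell : Set
  Cell = Fin (length w)

  open DecMembership (Fin._≟_ {length w}) using (_∈?_)

  notIn? : (S : List Cell) (i : Cell) → Dec (i ∉ S)
  notIn? S i = ¬? (i ∈? S)

  kept : List Cell → List Cell → List ℕ
  kept S L = map (lookup w) (filter (notIn? S) L)

  kept-++ : ∀ S L L′ → kept S (L ++ L′) ≡ kept S L ++ kept S L′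
  kept-++ S L L′ = trans (cong (map (lookup w)) (filter-++ (notIn? S) L L′)) (map-++ (lookup w) (filter (notIn? S) L) _)

  kept-∉ : ∀ {S x} → x ∉ S → kept S [ x ] ≡ [ lookup w x ]
  kept-∉ {S} x∉S = cong (map (lookup w)) (filter-accept (notIn? S) x∉S)

  kept-∈ : ∀ {S x} → x ∈ S → kept S [ x ] ≡ []
  kept-∈ {S} x∈S = cong (map (lookup w)) (filter-reject (notIn? S) (λ x∉S → x∉S x∈S))

  kept-cong : ∀ S S′ L → All (λ k → (k ∈ S → k ∈ S′) × (k ∈ S′ → k ∈ S)) L → kept S L ≡ kept S′ L
  kept-cong S S′ []      []                  = refl
  kept-cong S S′ (k ∷ L) ((to , from) ∷ L↔) with k ∈? S | k ∈? S′
  ... | yes k∈S | yes _    = kept-cong S S′ L L↔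
  ... | yes k∈S | no  k∉S′ = ⊥-elim (k∉S′ (to k∈S))
  ... | no  k∉S | yes k∈S′ = ⊥-elim (k∉S (from k∈S′))
  ... | no  _   | no  _    = cong (lookup w k ∷_) (kept-cong S S′ L L↔)

  kept-∷ : ∀ {x} S L → x ∉ L → kept (x ∷ S) L ≡ kept S L
  kept-∷ {x} S L x∉L = kept-cong (x ∷ S) S L (All.tabulate λ k∈L →
    (λ { (here refl) → ⊥-elim (x∉L k∈L) ; (there k∈S) → k∈S }) , there)

  removeCells-cong : ∀ S S′ → (∀ {k} → k ∈ S → k ∈ S′) → (∀ {k} → k ∈ S′ → k ∈ S) →
    removeCells w S ≡ removeCells w S′
  removeCells-cong S S′ to from = kept-cong S S′ (allFin (length w)) (All.tabulate λ _ → to , from)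

  allFin-sorted : AllPairs Fin._<_ (allFin (length w))
  allFin-sorted = tabulate⁺-< (λ i<j → i<j)

  below-∉ : ∀ {x z : Cell} {L} → All (Fin._< x) L → x Fin.≤ z → z ∉ L
  below-∉ L<x x≤z z∈L = <⇒≱ (All.lookup L<x z∈L) x≤z

  above-∉ : ∀ {x z : Cell} {L} → All (x Fin.<_) L → z Fin.≤ x → z ∉ L
  above-∉ x<L z≤x z∈L = <⇒≱ (All.lookup x<L z∈L) z≤x

  removeCells-∷ : ∀ {R x} → x ∉ R →
    ∃₂ λ A B → removeCells w R ≡ A ++ lookup w x ∷ B × removeCells w (x ∷ R) ≡ A ++ B
  removeCells-∷ {R} {x} x∉R with sortedSplit allFin-sorted (∈-allFin x)
  ... | L₁ , L₂ , cut , L₁<x , x<L₂ , _ =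
    kept R L₁ , kept R L₂ , pieces R refl (kept-∉ x∉R) refl ,
    pieces (x ∷ R) (kept-∷ R L₁ (below-∉ L₁<x ≤-refl)) (kept-∈ {x ∷ R} (here refl))
                   (kept-∷ R L₂ (above-∉ x<L₂ ≤-refl))
    where
    pieces : ∀ S {A X B} → kept S L₁ ≡ A → kept S [ x ] ≡ X → kept S L₂ ≡ B → removeCells w S ≡ A ++ X ++ B
    pieces S refl refl refl =
      trans (cong (kept S) cut) (trans (kept-++ S L₁ (x ∷ L₂)) (cong (kept S L₁ ++_) (kept-++ S [ x ] L₂)))

  record Gap (R : List Cell) (x z : Cell) : Set where
    field
      A E       : List ℕ
      middle    : List Cell
      between   : ∀ {k} → k ∈ middle → x Fin.< k × k Fin.< z
      complete  : ∀ {k} → x Fin.< k → k Fin.< z → k ∉ R → k ∈ middle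

    C : List ℕ
    C = map (lookup w) middle

    field
      removeCells-R  : removeCells w R ≡ A ++ lookup w x ∷ C ++ lookup w z ∷ E
      removeCells-x  : removeCells w (x ∷ R) ≡ A ++ C ++ lookup w z ∷ E
      removeCells-z  : removeCells w (z ∷ R) ≡ A ++ lookup w x ∷ C ++ E
      removeCells-xz : removeCells w (x ∷ z ∷ R) ≡ A ++ C ++ E

  gap : ∀ {R x z} → x Fin.< z → x ∉ R → z ∉ R → Gap R x z
  gap {R} {x} {z} x<z x∉R z∉R with sortedSplit allFin-sorted (∈-allFin x)
  ... | L₁ , L₂ , cut₁ , L₁<x , x<L₂ , sorted₂ with sortedSplit sorted₂ z∈L₂
    where
    z∈L₂ : z ∈ L₂
    z∈L₂ with ∈-++⁻ L₁ (subst (z ∈_) cut₁ (∈-allFin z))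
    ... | inj₁ z∈L₁         = ⊥-elim (below-∉ L₁<x (<⇒≤ x<z) z∈L₁)
    ... | inj₂ (here z≡x)   = ⊥-elim (Fin.<-irrefl (sym z≡x) x<z)
    ... | inj₂ (there z∈L₂) = z∈L₂
  ... | M , L₃ , refl , M<z , z<L₃ , _ = record
    { A = kept R L₁ ; E = kept R L₃ ; middle = filter (notIn? R) M
    ; between = λ k∈ → let k∈M , _ = ∈-filter⁻ (notIn? R) k∈ in All.lookup x<M k∈M , All.lookup M<z k∈M
    ; complete = complete
    ; removeCells-R = pieces R refl (kept-∉ x∉R) refl (kept-∉ z∉R) refl
    ; removeCells-x = pieces (x ∷ R) (kept-∷ R L₁ x∉L₁) (kept-∈ {x ∷ R} (here refl)) (kept-∷ R M x∉M)
                        (kept-∉ z∉xR) (kept-∷ R L₃ x∉L₃)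
    ; removeCells-z = pieces (z ∷ R) (kept-∷ R L₁ z∉L₁) (kept-∉ x∉zR) (kept-∷ R M z∉M)
                        (kept-∈ {z ∷ R} (here refl)) (kept-∷ R L₃ z∉L₃)
    ; removeCells-xz = pieces (x ∷ z ∷ R) (trans (kept-∷ (z ∷ R) L₁ x∉L₁) (kept-∷ R L₁ z∉L₁))
                        (kept-∈ {x ∷ z ∷ R} (here refl)) (trans (kept-∷ (z ∷ R) M x∉M) (kept-∷ R M z∉M))
                        (kept-∈ {x ∷ z ∷ R} (there (here refl))) (trans (kept-∷ (z ∷ R) L₃ x∉L₃) (kept-∷ R L₃ z∉L₃))
    }
    where
    x<M : All (x Fin.<_) M
    x<M = ++⁻ˡ M x<L₂
    x∉L₁ : x ∉ L₁
    x∉L₁ = below-∉ L₁<x ≤-refl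
    z∉L₁ : z ∉ L₁
    z∉L₁ = below-∉ L₁<x (<⇒≤ x<z)
    x∉M : x ∉ M
    x∉M = above-∉ x<M ≤-refl
    z∉M : z ∉ M
    z∉M = below-∉ M<z ≤-refl
    x∉L₃ : x ∉ L₃
    x∉L₃ = above-∉ z<L₃ (<⇒≤ x<z)
    z∉L₃ : z ∉ L₃
    z∉L₃ = above-∉ z<L₃ ≤-refl
    z∉xR : z ∉ x ∷ R
    z∉xR (here z≡x) = Fin.<-irrefl (sym z≡x) x<z
    z∉xR (there z∈R) = z∉R z∈R
    x∉zR : x ∉ z ∷ R
    x∉zR (here x≡z) = Fin.<-irrefl x≡z x<z
    x∉zR (there x∈R) = x∉R x∈R
    pieces : ∀ S {A X C Z E} →
             kept S L₁ ≡ A → kept S [ x ] ≡ X → kept S M ≡ C → kept S [ z ] ≡ Z → kept S L₃ ≡ E →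
             removeCells w S ≡ A ++ X ++ C ++ Z ++ E
    pieces S refl refl refl refl refl = begin
      kept S (allFin (length w))                    ≡⟨ cong (kept S) cut₁ ⟩
      kept S (L₁ ++ [ x ] ++ M ++ [ z ] ++ L₃)     ≡⟨ kept-++ S L₁ _ ⟩
      kept S L₁ ++ kept S ([ x ] ++ M ++ [ z ] ++ L₃) ≡⟨ cong (kept S L₁ ++_) (kept-++ S [ x ] _) ⟩
      kept S L₁ ++ kept S [ x ] ++ kept S (M ++ [ z ] ++ L₃)
        ≡⟨ cong (λ v → kept S L₁ ++ kept S [ x ] ++ v) (trans (kept-++ S M _) (cong (kept S M ++_) (kept-++ S [ z ] L₃))) ⟩
      kept S L₁ ++ kept S [ x ] ++ kept S M ++ kept S [ z ] ++ kept S L₃ ∎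
      where open ≡-Reasoning
    complete : ∀ {k} → x Fin.< k → k Fin.< z → k ∉ R → k ∈ filter (notIn? R) M
    complete {k} x<k k<z k∉R with ∈-++⁻ L₁ (subst (k ∈_) cut₁ (∈-allFin k))
    ... | inj₁ k∈L₁       = ⊥-elim (below-∉ L₁<x (<⇒≤ x<k) k∈L₁)
    ... | inj₂ (here k≡x) = ⊥-elim (Fin.<-irrefl (sym k≡x) x<k)
    ... | inj₂ (there k∈) with ∈-++⁻ M k∈
    ...   | inj₁ k∈M         = ∈-filter⁺ (notIn? R) k∈M k∉R
    ...   | inj₂ (here k≡z)  = ⊥-elim (Fin.<-irrefl k≡z k<z)
    ...   | inj₂ (there k∈L₃) = ⊥-elim (above-∉ z<L₃ (<⇒≤ k<z) k∈L₃)

  majDecrease : List Cell → List Cell → ℤ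
  majDecrease S S′ = + maj (removeCells w S) - + maj (removeCells w S′)

  decreasesFrom : List Cell → List Cell → List ℤ
  decreasesFrom R []      = []
  decreasesFrom R (x ∷ o) = majDecrease R (x ∷ R) ∷ decreasesFrom (x ∷ R) o

  decreases≡decreasesFrom : ∀ o → decreases w o ≡ decreasesFrom [] o
  decreases≡decreasesFrom o = begin
    decreases w o
      ≡⟨ map-cong (λ k → cong₂ majDecrease (sym (++-identityʳ (take k o))) (sym (++-identityʳ (take (suc k) o))))
                  (upTo (length o)) ⟩
    map (λ k → majDecrease (take k o ++ []) (take (suc k) o ++ [])) (upTo (length o))
      ≡⟨ shifted [] o ⟩
    decreasesFrom [] o ∎
    where
    open ≡-Reasoning
    shifted : ∀ R o → map (λ k → majDecrease (take k o ++ R) (take (suc k) o ++ R)) (upTo (length o)) ≡ decreasesFrom R o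
    shifted R []      = refl
    shifted R (x ∷ o) = cong (majDecrease R (x ∷ R) ∷_) (begin
      map (λ k → majDecrease (take k (x ∷ o) ++ R) (take (suc k) (x ∷ o) ++ R)) (applyUpTo suc (length o))
        ≡⟨ map-applyUpTo suc _ (length o) ⟩
      applyUpTo (λ k → majDecrease (x ∷ take k o ++ R) (x ∷ take (suc k) o ++ R)) (length o)
        ≡⟨ map-upTo _ (length o) ⟨
      map (λ k → majDecrease (x ∷ take k o ++ R) (x ∷ take (suc k) o ++ R)) (upTo (length o))
        ≡⟨ map-cong (λ k → cong₂ (λ u v → + maj u - + maj v) (moveToEnd (take k o)) (moveToEnd (take (suc k) o)))
                    (upTo (length o)) ⟩
      map (λ k → majDecrease (take k o ++ x ∷ R) (take (suc k) o ++ x ∷ R)) (upTo (length o))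
        ≡⟨ shifted (x ∷ R) o ⟩
      decreasesFrom (x ∷ R) o ∎)
      where
      moveToEnd : ∀ L → removeCells w (x ∷ L ++ R) ≡ removeCells w (L ++ x ∷ R)
      moveToEnd L = removeCells-cong (x ∷ L ++ R) (L ++ x ∷ R) (∈-resp-↭ (↭-sym (shift x L R))) (∈-resp-↭ (shift x L R))

module _ {A : Set} where

  Before-here : ∀ {i j : A} {t} → i ∈ t → Before j i (j ∷ t)
  Before-here {j = j} i∈t with ∈-∃++ i∈t
  ... | ys , zs , t≡ = [] , ys , zs , cong (j ∷_) t≡

  Before-there : ∀ {i j x : A} {t} → Before j i t → Before j i (x ∷ t)
  Before-there {x = x} (xs , ys , zs , t≡) = x ∷ xs , ys , zs , cong (x ∷_) t≡

  Before-there⁻ : ∀ {i j x : A} {t} → j ≢ x → Before j i (x ∷ t) → Before j i t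
  Before-there⁻ j≢x ([]     , _  , _  , x∷t≡) = ⊥-elim (j≢x (sym (∷-injectiveˡ x∷t≡)))
  Before-there⁻ j≢x (_ ∷ xs , ys , zs , x∷t≡) = xs , ys , zs , ∷-injectiveʳ x∷t≡

  Before⇒∈ : ∀ {i j : A} {t} → Before j i t → i ∈ t
  Before⇒∈ (xs , ys , zs , refl) = ∈-++⁺ʳ xs (there (∈-++⁺ʳ ys (here refl)))

  ∈-extract : ∀ {y : A} {L} → y ∈ L → ∃ λ rest → y ∷ rest ↭ L
  ∈-extract {y} y∈ with ∈-∃++ y∈
  ... | xs , ys , refl = xs ++ ys , ↭-sym (shift y xs ys)

-- The greedy ordering

module Greedy (w : List ℕ) (n : ℕ) (w≤n : All (_≤ n) w) where

  open Removal w

  Candidate : List Cell → Cell → Set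
  Candidate R x = x ∉ R × lookup w x ≡ n

  -- The truncated subtraction is harmless: for a candidate x the major index does drop (maj-removeCandidate).
  majDrop : List Cell → Cell → ℕ
  majDrop R x = maj (removeCells w R) ∸ maj (removeCells w (x ∷ R))

  removeCells-≤ : ∀ R → All (_≤ n) (removeCells w R)
  removeCells-≤ R = map⁺ (All.tabulate λ {k} _ → All.lookup w≤n (∈-lookup k))

  majDrop-cost : ∀ {R x A B} → removeCells w R ≡ A ++ n ∷ B → removeCells w (x ∷ R) ≡ A ++ B →
    majDrop R x ≡ removalCost n 1 A B
  majDrop-cost {R} {x} {A} {B} eqR eqx rewrite eqR | eqx
    | majFrom-insertMax 1 A B (++⁻ˡ A (subst (All (_≤ n)) eqR (removeCells-≤ R))) =
    m+n∸m≡n (maj (A ++ B)) (removalCost n 1 A B)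

  maj-removeCandidate : ∀ {R x} → Candidate R x → maj (removeCells w R) ≡ maj (removeCells w (x ∷ R)) + majDrop R x
  maj-removeCandidate {R} {x} (x∉R , x≡n) with removeCells-∷ x∉R
  ... | A , B , eqR , eqx = begin
    maj (removeCells w R)                             ≡⟨ cong maj eqR′ ⟩
    maj (A ++ n ∷ B)                                  ≡⟨ majFrom-insertMax 1 A B (++⁻ˡ A (subst (All (_≤ n)) eqR′ (removeCells-≤ R))) ⟩
    maj (A ++ B) + removalCost n 1 A B                ≡⟨ cong₂ (λ u v → maj u + v) (sym eqx) (sym (majDrop-cost eqR′ eqx)) ⟩
    maj (removeCells w (x ∷ R)) + majDrop R x         ∎
    where
    open ≡-Reasoning
    eqR′ : removeCells w R ≡ A ++ n ∷ B
    eqR′ = trans eqR (cong (λ v → A ++ v ∷ B) x≡n)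

  majDecrease≡majDrop : ∀ {R x} → Candidate R x → majDecrease R (x ∷ R) ≡ + majDrop R x
  majDecrease≡majDrop {R} {x} cx = begin
    + maj (removeCells w R) - + m  ≡⟨ cong (λ v → + v - + m) (maj-removeCandidate cx) ⟩
    + (m + d) - + m               ≡⟨ ℤ.[+m]-[+n]≡m⊖n (m + d) m ⟩
    (m + d) ℤ.⊖ m                 ≡⟨ ℤ.⊖-≥ (m≤m+n m d) ⟩
    + (m + d ∸ m)                 ≡⟨ cong +_ (m+n∸m≡n m d) ⟩
    + d                           ∎
    where
    open ≡-Reasoning
    m d : ℕ
    m = maj (removeCells w (x ∷ R))
    d = majDrop R x

  Removed : List Cell → Set
  Removed R = All (λ i → lookup w i ≡ n) R

  -- Cells are numbered from the top, so x lies above z.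
  module Pair {R x z} (R≡n : Removed R) (x<z : x Fin.< z) (cx : Candidate R x) (cz : Candidate R z) where

    open Gap (gap x<z (proj₁ cx) (proj₁ cz))

    private
      eqR : removeCells w R ≡ A ++ n ∷ C ++ n ∷ E
      eqR = trans removeCells-R (cong₂ (λ u v → A ++ u ∷ C ++ v ∷ E) (proj₂ cx) (proj₂ cz))

      eqx : removeCells w (x ∷ R) ≡ A ++ C ++ n ∷ E
      eqx = trans removeCells-x (cong (λ v → A ++ C ++ v ∷ E) (proj₂ cz))

      eqz : removeCells w (z ∷ R) ≡ A ++ n ∷ C ++ E
      eqz = trans removeCells-z (cong (λ u → A ++ u ∷ C ++ E) (proj₂ cx))

      eqzx : removeCells w (z ∷ x ∷ R) ≡ A ++ C ++ E
      eqzx = trans (removeCells-cong (z ∷ x ∷ R) (x ∷ z ∷ R) swap swap) removeCells-xz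
        where
        swap : ∀ {a b k} → k ∈ a ∷ b ∷ R → k ∈ b ∷ a ∷ R
        swap (here k≡a)         = there (here k≡a)
        swap (there (here k≡b)) = here k≡b
        swap (there (there k∈R)) = there (there k∈R)

      majDrop-x : majDrop R x ≡ removalCost n 1 A (C ++ n ∷ E)
      majDrop-x = majDrop-cost eqR eqx

      majDrop-z : majDrop R z ≡ removalCost n 1 (A ++ n ∷ C) E
      majDrop-z = majDrop-cost (trans eqR (sym (++-assoc A (n ∷ C) (n ∷ E)))) (trans eqz (sym (++-assoc A (n ∷ C) E)))

      majDrop-x-z : majDrop (x ∷ R) z ≡ removalCost n 1 (A ++ C) E
      majDrop-x-z = majDrop-cost (trans eqx (sym (++-assoc A C (n ∷ E)))) (trans eqzx (sym (++-assoc A C E)))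

      majDrop-z-x : majDrop (z ∷ R) x ≡ removalCost n 1 A (C ++ E)
      majDrop-z-x = majDrop-cost eqz removeCells-xz

      ACE≤n : All (_≤ n) (A ++ n ∷ C ++ n ∷ E)
      ACE≤n = subst (All (_≤ n)) eqR (removeCells-≤ R)

      A≤n : All (_≤ n) A
      A≤n = ++⁻ˡ A ACE≤n

      C≤n : All (_≤ n) C
      C≤n with ++⁻ʳ A ACE≤n
      ... | _ ∷ CE≤n = ++⁻ˡ C CE≤n

      sameRun⁻ : SameRun w n x z → All (_≡ n) C
      sameRun⁻ (_ , run) = map⁺ (All.tabulate λ k∈ → run _ (<⇒≤ (proj₁ (between k∈))) (<⇒≤ (proj₂ (between k∈))))

      sameRun⁺ : All (_≡ n) C → SameRun w n x z
      sameRun⁺ C≡n = x<z , run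
        where
        run : ∀ k → toℕ x ≤ toℕ k → toℕ k ≤ toℕ z → lookup w k ≡ n
        run k x≤k k≤z with x Fin.≟ k | k Fin.≟ z
        ... | yes refl | _        = proj₂ cx
        ... | no  _    | yes refl = proj₂ cz
        ... | no  x≢k  | no  k≢z with any? (k Fin.≟_) R
        ...   | yes k∈R = All.lookup R≡n k∈R
        ...   | no  k∉R = All.lookup C≡n (∈-map⁺ (lookup w) (complete x<k k<z k∉R))
          where
          x<k : x Fin.< k
          x<k = ≤∧≢⇒< x≤k (x≢k ∘ Fin.toℕ-injective)
          k<z : k Fin.< z
          k<z = ≤∧≢⇒< k≤z (k≢z ∘ Fin.toℕ-injective)

      nonempty : ¬ SameRun w n x z → ∃₂ λ y ys → C ≡ y ∷ ys
      nonempty ¬run with C in C≡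
      ... | []     = ⊥-elim (¬run (sameRun⁺ (subst (All (_≡ n)) (sym C≡) [])))
      ... | y ∷ ys = y , ys , refl

    sameRun? : Dec (SameRun w n x z)
    sameRun? with All.all? (_≟ n) C
    ... | yes C≡n = yes (sameRun⁺ C≡n)
    ... | no  C≢n = no (C≢n ∘ sameRun⁻)

    majDrop-sameRun : SameRun w n x z → majDrop R x ≡ majDrop R z
    majDrop-sameRun run = trans majDrop-x (trans (removalCost-run A C E A≤n (sameRun⁻ run)) (sym majDrop-z))

    majDrop-≢ : ¬ SameRun w n x z → majDrop R x ≢ majDrop R z
    majDrop-≢ ¬run eq = removalCost-≢ A C E C≤n (¬run ∘ sameRun⁺) (trans (sym majDrop-x) (trans eq majDrop-z))

    majDrop-removeUpper : ¬ SameRun w n x z →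
      majDrop (x ∷ R) z ≤ majDrop R z × majDrop R z ≤ suc (majDrop (x ∷ R) z)
    majDrop-removeUpper ¬run with nonempty ¬run
    ... | y , ys , C≡ rewrite majDrop-x-z | majDrop-z | C≡ = removalCost-insertLeft n A y ys E

    majDrop-removeLower : ¬ SameRun w n x z →
      majDrop (z ∷ R) x ≤ majDrop R x × majDrop R x ≤ suc (majDrop (z ∷ R) x)
    majDrop-removeLower ¬run with nonempty ¬run
    ... | y , ys , C≡ rewrite majDrop-z-x | majDrop-x | C≡ = removalCost-insertRight n A y ys E (subst (All (_≤ n)) C≡ C≤n)

    majDrop-run-removeLower : SameRun w n x z → majDrop R z ≤ majDrop (z ∷ R) x
    majDrop-run-removeLower run rewrite majDrop-z | majDrop-z-x = removalCost-run-≤ A C E (sameRun⁻ run)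

  -- R lists the cells removed so far, the latest first; rem lists the n-cells still present.
  record State (R rem : List Cell) : Set where
    field
      unique   : Unique rem
      sound    : ∀ {i} → i ∈ rem → Candidate R i
      complete : ∀ {i} → Candidate R i → i ∈ rem
      removed  : Removed R

  State-resp-↭ : ∀ {R rem rem′} → rem ↭ rem′ → State R rem → State R rem′
  State-resp-↭ p st = record
    { unique   = Unique-resp-↭ (setoid Cell) (↭⇒↭ₛ p) unique
    ; sound    = sound ∘ ∈-resp-↭ (↭-sym p)
    ; complete = ∈-resp-↭ p ∘ complete
    ; removed  = removed
    }
    where open State st

  State-∷ : ∀ {R x t} → State R (x ∷ t) → State (x ∷ R) t
  State-∷ {R} {x} {t} st = record
    { unique   = t-unique
    ; sound    = λ i∈t → i∉xR i∈t , proj₂ (sound (there i∈t))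
    ; complete = complete′
    ; removed  = proj₂ (sound (here refl)) ∷ removed
    }
    where
    open State st
    x∉t : x ∉ t
    x∉t = Unique[x∷xs]⇒x∉xs unique
    t-unique : Unique t
    t-unique with unique
    ... | _ ∷ u = u
    i∉xR : ∀ {i} → i ∈ t → i ∉ x ∷ R
    i∉xR i∈t (here refl) = x∉t i∈t
    i∉xR i∈t (there i∈R) = proj₁ (sound (there i∈t)) i∈R
    complete′ : ∀ {i} → Candidate (x ∷ R) i → i ∈ t
    complete′ (i∉xR , i≡n) with complete ((i∉xR ∘ there) , i≡n)
    ... | here refl = ⊥-elim (i∉xR (here refl))
    ... | there i∈t = i∈t

  State-step : ∀ {R rem x t} → x ∷ t ↭ rem → State R rem → State (x ∷ R) t
  State-step p st = State-∷ (State-resp-↭ (↭-sym p) st)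

  record GreedyChoice (R : List Cell) (y : Cell) : Set where
    field
      candidate : Candidate R y
      minimal   : ∀ {z} → Candidate R z → majDrop R y ≤ majDrop R z
      lowest    : ∀ {z} → Candidate R z → y Fin.< z → majDrop R y < majDrop R z

  GreedyChoice-<⇒⊥ : ∀ {R y₁ y₂} → GreedyChoice R y₁ → GreedyChoice R y₂ → ¬ y₁ Fin.< y₂
  GreedyChoice-<⇒⊥ g₁ g₂ y₁<y₂ =
    <⇒≱ (GreedyChoice.lowest g₁ (GreedyChoice.candidate g₂) y₁<y₂) (GreedyChoice.minimal g₂ (GreedyChoice.candidate g₁))

  GreedyChoice-unique : ∀ {R y₁ y₂} → GreedyChoice R y₁ → GreedyChoice R y₂ → y₁ ≡ y₂
  GreedyChoice-unique {y₁ = y₁} {y₂} g₁ g₂ with Fin.<-cmp y₁ y₂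
  ... | tri< y₁<y₂ _ _ = ⊥-elim (GreedyChoice-<⇒⊥ g₁ g₂ y₁<y₂)
  ... | tri≈ _ y₁≡y₂ _ = y₁≡y₂
  ... | tri> _ _ y₂<y₁ = ⊥-elim (GreedyChoice-<⇒⊥ g₂ g₁ y₂<y₁)

  majDrop-removeOther : ∀ {R u z} → Removed R → Candidate R u → Candidate R z → u ≢ z →
    majDrop R u ≡ majDrop R z ⊎ majDrop (u ∷ R) z ≤ majDrop R z
  majDrop-removeOther {u = u} {z} R≡n cu cz u≢z with Fin.<-cmp u z
  ... | tri≈ _ u≡z _ = ⊥-elim (u≢z u≡z)
  ... | tri< u<z _ _ = let open Pair R≡n u<z cu cz in case sameRun? of λ where
    (yes run) → inj₁ (majDrop-sameRun run)
    (no ¬run) → inj₂ (proj₁ (majDrop-removeUpper ¬run))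
  ... | tri> _ _ z<u = let open Pair R≡n z<u cz cu in case sameRun? of λ where
    (yes run) → inj₁ (sym (majDrop-sameRun run))
    (no ¬run) → inj₂ (proj₁ (majDrop-removeLower ¬run))

  majDrop-next : ∀ {R y x} → Removed R → GreedyChoice R y → Candidate (y ∷ R) x → majDrop R y ≤ majDrop (y ∷ R) x
  majDrop-next {R} {y} {x} R≡n g (x∉yR , x≡n) = compare (Fin.<-cmp x y)
    where
    open GreedyChoice g
    cx : Candidate R x
    cx = x∉yR ∘ there , x≡n
    compare : Tri (x Fin.< y) (x ≡ y) (y Fin.< x) → majDrop R y ≤ majDrop (y ∷ R) x
    compare (tri≈ _ x≡y _) = ⊥-elim (x∉yR (here x≡y))
    compare (tri< x<y _ _) = let open Pair R≡n x<y cx candidate in case sameRun? of λ where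
      (yes run) → majDrop-run-removeLower run
      (no ¬run) → ≤-pred (≤-trans (≤∧≢⇒< (minimal cx) (majDrop-≢ ¬run ∘ sym)) (proj₂ (majDrop-removeLower ¬run)))
    compare (tri> _ _ y<x) = let open Pair R≡n y<x candidate cx in case sameRun? of λ where
      (yes run) → ⊥-elim (<-irrefl (majDrop-sameRun run) (lowest cx y<x))
      (no ¬run) → ≤-pred (≤-trans (lowest cx y<x) (proj₂ (majDrop-removeUpper ¬run)))

  RunsBottomUp : List Cell → Set
  RunsBottomUp o = ∀ {i j} → SameRun w n i j → i ∈ o → j ∈ o → Before j i o

  head-∉ : ∀ {R rem x t} → State R rem → x ∷ t ↭ rem → x ∉ t
  head-∉ st p x∈t = proj₁ (State.sound (State-step p st) x∈t) (here refl)

  -- Removing a cell u never raises the d of another candidate z unless d(u) = d(z), so a lower bound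
  -- for all the decreases along o bounds every current d.
  majDrop-lowerBound : ∀ {R rem o δ z} → State R rem → o ↭ rem → All (+ δ ℤ.≤_) (decreasesFrom R o) →
    Candidate R z → δ ≤ majDrop R z
  majDrop-lowerBound {o = []} st p _ cz with ∈-resp-↭ (↭-sym p) (State.complete st cz)
  ... | ()
  majDrop-lowerBound {R} {o = u ∷ o} {δ} {z} st p (δ≤u ∷ δ≤o) cz = bound (u Fin.≟ z)
    where
    cu : Candidate R u
    cu = State.sound st (∈-resp-↭ p (here refl))
    δ≤majDrop-u : δ ≤ majDrop R u
    δ≤majDrop-u = ℤ.drop‿+≤+ (subst (+ δ ℤ.≤_) (majDecrease≡majDrop cu) δ≤u)
    bound : Dec (u ≡ z) → δ ≤ majDrop R z
    bound (yes refl) = δ≤majDrop-u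
    bound (no u≢z) with majDrop-removeOther (State.removed st) cu cz u≢z
    ... | inj₁ u≡z      = subst (δ ≤_) u≡z δ≤majDrop-u
    ... | inj₂ decrease = ≤-trans (majDrop-lowerBound (State-step p st) ↭-refl δ≤o cz′) decrease
      where
      cz′ : Candidate (u ∷ R) z
      cz′ = (λ { (here z≡u) → u≢z (sym z≡u) ; (there z∈R) → proj₁ cz z∈R }) , proj₂ cz

  greedyChoice-head : ∀ {R rem x t} → State R rem → x ∷ t ↭ rem →
    Linked ℤ._≤_ (decreasesFrom R (x ∷ t)) → RunsBottomUp (x ∷ t) → GreedyChoice R x
  greedyChoice-head {R} {rem} {x} {t} st p linked runs = record
    { candidate = cx ; minimal = minimal ; lowest = lowest }
    where
    open State st
    cx : Candidate R x
    cx = sound (∈-resp-↭ p (here refl))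
    minimal : ∀ {z} → Candidate R z → majDrop R x ≤ majDrop R z
    minimal = majDrop-lowerBound st p (Linked⇒All ℤ.≤-trans (ℤ.≤-reflexive (sym (majDecrease≡majDrop cx))) linked)
    lowest : ∀ {z} → Candidate R z → x Fin.< z → majDrop R x < majDrop R z
    lowest cz x<z = ≤∧≢⇒< (minimal cz) λ eq → case sameRun? of λ where
        (yes run) → head-∉ st p (Before⇒∈ (Before-there⁻ (Fin.<⇒≢ x<z ∘ sym)
                                   (runs run (here refl) (∈-resp-↭ (↭-sym p) (complete cz)))))
        (no ¬run) → majDrop-≢ ¬run eq
      where open Pair removed x<z cx cz

  RunsBottomUp-tail : ∀ {x t} → x ∉ t → RunsBottomUp (x ∷ t) → RunsBottomUp t
  RunsBottomUp-tail x∉t runs run i∈t j∈t =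
    Before-there⁻ (λ { refl → x∉t j∈t }) (runs run (there i∈t) (there j∈t))

  orderings-unique : ∀ {R rem o₁ o₂} → State R rem → o₁ ↭ rem → o₂ ↭ rem →
    Linked ℤ._≤_ (decreasesFrom R o₁) → Linked ℤ._≤_ (decreasesFrom R o₂) →
    RunsBottomUp o₁ → RunsBottomUp o₂ → o₁ ≡ o₂
  orderings-unique {o₁ = []}     {[]}     _  _  _  _  _  _  _  = refl
  orderings-unique {o₁ = []}     {_ ∷ _}  _  p₁ p₂ _  _  _  _  with ∈-resp-↭ (↭-sym p₁) (∈-resp-↭ p₂ (here refl))
  ... | ()
  orderings-unique {o₁ = _ ∷ _}  {[]}     _  p₁ p₂ _  _  _  _  with ∈-resp-↭ (↭-sym p₂) (∈-resp-↭ p₁ (here refl))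
  ... | ()
  orderings-unique {o₁ = x ∷ t₁} {y ∷ t₂} st p₁ p₂ l₁ l₂ r₁ r₂
    with GreedyChoice-unique (greedyChoice-head st p₁ l₁ r₁) (greedyChoice-head st p₂ l₂ r₂)
  ... | refl = cong (x ∷_) (orderings-unique (State-step p₁ st) ↭-refl t₂↭t₁ (tail l₁) (tail l₂)
                 (RunsBottomUp-tail (head-∉ st p₁) r₁) (RunsBottomUp-tail (head-∉ st p₂) r₂))
    where
    t₂↭t₁ : t₂ ↭ t₁
    t₂↭t₁ = drop-∷ (↭-trans p₂ (↭-sym p₁))

  module _ (R : List Cell) where

    open import Data.List.Extrema (×-totalOrder ≤-decTotalOrder (Flip.totalOrder (Fin.≤-totalOrder (length w))))
      using (argmin; argmin-sel; f[argmin]≤f[⊤]; f[argmin]≤f[xs])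

    -- Reversing the cell order in the lexicographic key breaks ties in favour of the lowest cell.
    private
      key : Cell → ℕ × Cell
      key z = majDrop R z , z

      key-≤ : ∀ {y z} → ×-Lex _≡_ _≤_ (flip Fin._≤_) (key y) (key z) →
        majDrop R y ≤ majDrop R z × (y Fin.< z → majDrop R y < majDrop R z)
      key-≤ (inj₁ (le , ne)) = le , λ _ → ≤∧≢⇒< le ne
      key-≤ (inj₂ (eq , z≤y)) = ≤-reflexive eq , λ y<z → ⊥-elim (<⇒≱ y<z z≤y)

    greedyChoice-exists : ∀ {r rs} → State R (r ∷ rs) → ∃ λ y → y ∈ r ∷ rs × GreedyChoice R y
    greedyChoice-exists {r} {rs} st = y , y∈ , record
      { candidate = sound y∈
      ; minimal   = λ cz → proj₁ (key-≤ (y≤ (complete cz)))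
      ; lowest    = λ cz → proj₂ (key-≤ (y≤ (complete cz)))
      }
      where
      open State st
      y : Cell
      y = argmin key r rs
      y∈ : y ∈ r ∷ rs
      y∈ with argmin-sel key r rs
      ... | inj₁ y≡r  = here y≡r
      ... | inj₂ y∈rs = there y∈rs
      y≤ : ∀ {z} → z ∈ r ∷ rs → ×-Lex _≡_ _≤_ (flip Fin._≤_) (key y) (key z)
      y≤ (here refl)  = f[argmin]≤f[⊤] {f = key} r rs
      y≤ (there z∈rs) = All.lookup (f[argmin]≤f[xs] {f = key} r rs) z∈rs

  greedyChoice-cons : ∀ {R rem y rest o} → State R rem → y ∷ rest ↭ rem → GreedyChoice R y → o ↭ rest →
    Linked ℤ._≤_ (decreasesFrom (y ∷ R) o) → RunsBottomUp o →
    y ∷ o ↭ rem × Linked ℤ._≤_ (decreasesFrom R (y ∷ o)) × RunsBottomUp (y ∷ o)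
  greedyChoice-cons {R} {rem} {y} {rest} {o} st q g p linked runs = ↭-trans (↭-prep y p) q , linked′ o p linked , runs′
    where
    open GreedyChoice g
    st′ : State (y ∷ R) rest
    st′ = State-step q st
    linked′ : ∀ o → o ↭ rest → Linked ℤ._≤_ (decreasesFrom (y ∷ R) o) → Linked ℤ._≤_ (decreasesFrom R (y ∷ o))
    linked′ []      _ _      = [-]
    linked′ (h ∷ _) p linked = step ∷ linked
      where
      ch : Candidate (y ∷ R) h
      ch = State.sound st′ (∈-resp-↭ p (here refl))
      step : majDecrease R (y ∷ R) ℤ.≤ majDecrease (y ∷ R) (h ∷ y ∷ R)
      step = subst₂ ℤ._≤_ (sym (majDecrease≡majDrop candidate)) (sym (majDecrease≡majDrop ch))
                    (ℤ.+≤+ (majDrop-next (State.removed st) g ch))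
    runs′ : RunsBottomUp (y ∷ o)
    runs′ {i} {j} run i∈ j∈ with j Fin.≟ y | i Fin.≟ y | i∈ | j∈
    ... | yes refl | _        | here refl | _         = ⊥-elim (Fin.<-irrefl refl (proj₁ run))
    ... | yes refl | _        | there i∈o | _         = Before-here i∈o
    ... | no j≢y   | _        | _         | here j≡y  = ⊥-elim (j≢y j≡y)
    ... | no _     | yes refl | _         | there j∈o =
      ⊥-elim (<-irrefl (Pair.majDrop-sameRun (State.removed st) (proj₁ run) candidate cj run) (lowest cj (proj₁ run)))
      where
      cj : Candidate R j
      cj = State.sound st (∈-resp-↭ q (there (∈-resp-↭ p j∈o)))
    ... | no _     | no i≢y   | here i≡y  | there _   = ⊥-elim (i≢y i≡y)
    ... | no _     | no _     | there i∈o | there j∈o = Before-there (runs run i∈o j∈o)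

  orderings-exist : ∀ m {R rem} → length rem ≡ m → State R rem →
    ∃ λ o → o ↭ rem × Linked ℤ._≤_ (decreasesFrom R o) × RunsBottomUp o
  orderings-exist _       {rem = []}     _   _  = [] , ↭-refl , [] , λ _ ()
  orderings-exist (suc m) {R} {r ∷ rs} len st with greedyChoice-exists R st
  ... | y , y∈ , g with ∈-extract y∈
  ... | rest , q with orderings-exist m (suc-injective (trans (↭-length q) len)) (State-step q st)
  ... | o , p , linked , runs = y ∷ o , greedyChoice-cons st q g p linked runs

  initialState : State [] (cellsOf w n)
  initialState = record
    { unique   = filter⁺ isN? (allFin⁺ (length w))
    ; sound    = λ i∈ → (λ ()) , proj₂ (∈-filter⁻ isN? {xs = allFin (length w)} i∈)
    ; complete = λ (_ , i≡n) → ∈-filter⁺ isN? (∈-allFin _) i≡n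
    ; removed  = []
    }
    where
    isN? : (i : Cell) → Dec (lookup w i ≡ n)
    isN? i = lookup w i ≟ n

  sameRun-∈ : ∀ {o i j} → o ↭ cellsOf w n → SameRun w n i j → i ∈ o × j ∈ o
  sameRun-∈ p (i<j , run) =
    ∈-resp-↭ (↭-sym p) (State.complete initialState ((λ ()) , run _ ≤-refl (<⇒≤ i<j))) ,
    ∈-resp-↭ (↭-sym p) (State.complete initialState ((λ ()) , run _ (<⇒≤ i<j) ≤-refl))

  goodOrdering-exists : ∃ (GoodOrdering w n)
  goodOrdering-exists with orderings-exist _ refl initialState
  ... | o , p , linked , runs =
    o , p , (λ i j run → let i∈ , j∈ = sameRun-∈ p run in runs run i∈ j∈) ,
    subst (Linked ℤ._≤_) (sym (decreases≡decreasesFrom o)) linked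

  goodOrdering-unique : ∀ {o₁ o₂} → GoodOrdering w n o₁ → GoodOrdering w n o₂ → o₁ ≡ o₂
  goodOrdering-unique {o₁} {o₂} (p₁ , r₁ , l₁) (p₂ , r₂ , l₂) =
    orderings-unique initialState p₁ p₂
      (subst (Linked ℤ._≤_) (decreases≡decreasesFrom o₁) l₁) (subst (Linked ℤ._≤_) (decreases≡decreasesFrom o₂) l₂)
      (λ run _ _ → r₁ _ _ run) (λ run _ _ → r₂ _ _ run)

-- Neither the positivity of the entries nor n ∈ w is needed.
mainTheorem16 : (w : List ℕ) → All (0 <_) w → (n : ℕ) → n ∈ w → All (_≤ n) w →
    ∃[ o ] (GoodOrdering w n o
    × (∀ (o′ : List (Fin (length w))) → GoodOrdering w n o′ → o′ ≡ o))
mainTheorem16 w _ n _ w≤n =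
  let o , good = goodOrdering-exists in o , good , λ _ good′ → goodOrdering-unique good′ good
  where open Greedy w n w≤n
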